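{- Let $\alpha$ be a non-degenerate $(s+2t)$-simplex with vertices among the vertices of $\Pi^*_{s,t}$. No two distinct exterior faces of $\alpha$ of dimension at least $1$ can be contained in parallel faces of $\Pi^*_{s,t}$.
   Context: $\Pi^*_{s,t}$ is the product of $s$ copies of $\Delta^1$ and $t$ copies of $\Delta^2$ ($\Delta^d$ the $d$-simplex spanned by the standard unit vectors of $\mathbb{R}^{d+1}$), in standard coordinates with one block per factor; vertices are the $0/1$ points. Non-degenerate means the vertices of $\alpha$ are affinely independent. An exterior $k$-face of $\alpha$ is a $k$-face of $\alpha$ whose $k+1$ vertices lie in a common $k$-dimensional face of $\Pi^*_{s,t}$ (and it is said to be contained in that face). For a subset $A$ of the simplotope, a standard coordinate is free on $A$ if it is neither identically $0$ nor identically $1$ on $A$. Two faces of the simplotope are parallel if they have exactly the same free coordinates. -}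

module Defs where

open import Data.Nat using (ℕ; zero; suc; _+_; _*_; _∸_; _≤_)
open import Data.Fin using (Fin; zero; suc; _≟_)
open import Data.Fin.Subset using (Subset; _∈_; ∣_∣; Nonempty)
open import Data.Product using (Σ; _×_; _,_; ∃)
open import Data.Sum using (_⊎_; inj₁; inj₂)
import Data.Integer as ℤ
open import Data.Rational as ℚ using (ℚ; 0ℚ; 1ℚ)
open import Relation.Nullary using (¬_; yes; no)
open import Relation.Binary.PropositionalEquality using (_≡_; _≢_)

sumℕ : ∀ {n} → (Fin n → ℕ) → ℕ
sumℕ {zero}  f = 0
sumℕ {suc n} f = f zero + sumℕ (λ i → f (suc i))

sumℚ : ∀ {n} → (Fin n → ℚ) → ℚ
sumℚ {zero}  f = 0ℚ
sumℚ {suc n} f = f zero ℚ.+ sumℚ (λ i → f (suc i))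

-- A vertex of Π*_{s,t} = (Δ¹)^s × (Δ²)^t : a vertex of each factor.
record Vertex (s t : ℕ) : Set where
  constructor vtx
  field
    fst₁ : Fin s → Fin 2
    snd₂ : Fin t → Fin 3
open Vertex public

-- Standard coordinates of ℝ^{2s+3t}: one block of 2 coords per Δ¹ factor,
-- one block of 3 coords per Δ² factor.
Coord : ℕ → ℕ → Set
Coord s t = (Fin s × Fin 2) ⊎ (Fin t × Fin 3)

indicator : ∀ {n} → Fin n → Fin n → ℕ
indicator a b with a ≟ b
... | yes _ = 1
... | no  _ = 0

coord : ∀ {s t} → Vertex s t → Coord s t → ℕ
coord v (inj₁ (i , a)) = indicator (fst₁ v i) a
coord v (inj₂ (j , a)) = indicator (snd₂ v j) a

-- Affine independence (over ℚ; vertices have integer coordinates)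
AffinelyIndependent : ∀ {s t m} → (Fin m → Vertex s t) → Set
AffinelyIndependent {s} {t} {m} α =
  (λ' : Fin m → ℚ) →
  sumℚ λ' ≡ 0ℚ →
  ((c : Coord s t) → sumℚ (λ i → λ' i ℚ.* (ℤ.+ (coord (α i) c) ℚ./ 1)) ≡ 0ℚ) →
  (i : Fin m) → λ' i ≡ 0ℚ

-- A face of Π*_{s,t}: a product of (nonempty) faces of the factors,
-- each factor face given by its nonempty vertex set.
record Face (s t : ℕ) : Set where
  constructor face
  field
    S  : Fin s → Subset 2
    T  : Fin t → Subset 3
    S≠∅ : (i : Fin s) → Nonempty (S i)
    T≠∅ : (j : Fin t) → Nonempty (T j)
open Face public

dim : ∀ {s t} → Face s t → ℕ
dim F = sumℕ (λ i → ∣ S F i ∣ ∸ 1) + sumℕ (λ j → ∣ T F j ∣ ∸ 1)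

_∈F_ : ∀ {s t} → Vertex s t → Face s t → Set
v ∈F F = ((i : _) → fst₁ v i ∈ S F i) × ((j : _) → snd₂ v j ∈ T F j)

-- A standard coordinate is free on F: neither identically 0 nor identically 1
-- on F (coordinates are affine, so it suffices to test the vertices of F).
Free : ∀ {s t} → Face s t → Coord s t → Set
Free F c = (¬ ((v : _) → v ∈F F → coord v c ≡ 0))
         × (¬ ((v : _) → v ∈F F → coord v c ≡ 1))

Parallel : ∀ {s t} → Face s t → Face s t → Set
Parallel F G = (c : _) → (Free F c → Free G c) × (Free G c → Free F c)

-- The face of α with vertex set β (a subset of α's vertex indices)
-- is an exterior k-face contained in the face F of Π*:
-- |β| = k+1, dim F = k, and all vertices of β lie in F.
ExteriorIn : ∀ {s t m} → (Fin m → Vertex s t) → Subset m → ℕ → Face s t → Set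
ExteriorIn α β k F =
  (∣ β ∣ ≡ suc k) × (dim F ≡ k) × ((i : _) → i ∈ β → α i ∈F F)

module Submission where

-- A weight vector l on the vertices of α is an affine dependence when it has
-- total weight 0 and Σ lᵢ·αᵢ = 0.  The coordinates that are not free on a
-- face F are constant on F, and a direction vector of F is pinned down by
-- dim F further coordinates (directionCoords).  Since a homogeneous linear
-- system with fewer equations than unknowns has a nonzero solution
-- (LinearAlgebra), affinely independent vertices of α lying in r translates
-- of F number at most dim F + r (dimensionBound; oneTranslate for r = 1,
-- twoTranslates for r = 2).  For exterior faces β₁ ⊆ F₁, β₂ ⊆ F₂ with F₁ ∥ F₂:
-- if β₁ and β₂ are disjoint, their k₁ + k₂ + 2 ≥ k₁ + 3 vertices lie in two
-- translates of F₁ (disjointExterior); if they share a vertex, F₁ and F₂ lie in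
-- one translate, and β₁ together with a vertex of the other face outside β₁
-- gives k₁ + 2 vertices in it (overlappingExterior).

open import Defs
open import Data.Nat using (ℕ; zero; suc; _<_; _≤_; s≤s; z≤n)
open import Data.Nat.Properties as ℕP using (m<n⇒m<1+n; suc-injective; +-suc)
open import Data.Bool as Bool using (Bool; true; false; not; _∨_; if_then_else_)
open import Data.Fin as Fin using (Fin; zero; suc; punchIn)
open import Data.Fin.Properties using (any?; all?; ¬∀⟶∃¬; punchInᵢ≢i)
open import Data.Fin.Subset using (Subset; _∈_; ∣_∣; ⁅_⁆)
open import Data.Fin.Subset.Properties using (∣⁅x⁆∣≡1; x∈⁅y⁆⇒x≡y)
open import Data.Vec using ([]; _∷_; lookup)
open import Data.Vec.Properties using ([]=⇒lookup; lookup⇒[]=; tabulate∘lookup; tabulate-cong)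
open import Data.Vec.Functional using (Vector)
open import Data.List using (List; []; _∷_; length; map; _++_)
open import Data.List.Properties using (length-++; length-map)
open import Data.List.Relation.Unary.All as All using (All; []; _∷_)
open import Data.List.Relation.Unary.All.Properties using (map⁻; ++⁻ˡ; ++⁻ʳ)
open import Data.Product using (Σ; ∃; _×_; _,_; proj₁; proj₂)
open import Data.Sum using (_⊎_; inj₁; inj₂)
open import Data.Empty using (⊥)
open import Function using (_∘_)
open import Relation.Nullary using (¬_; yes; no)
open import Relation.Nullary.Negation using (contradiction)
open import Relation.Nullary.Decidable using (_×-dec_)
open import Relation.Binary.PropositionalEquality
open import Algebra.Bundles using (CommutativeRing)
import Algebra.Properties.Semiring.Sum as SemiringSum
import Data.Integer as ℤ
open import Data.Rational as ℚ using (ℚ; 0ℚ; 1ℚ)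
import Data.Rational.Properties as ℚP

module ℚΣ = SemiringSum (CommutativeRing.semiring ℚP.+-*-commutativeRing)
module ℕΣ = SemiringSum ℕP.+-*-semiring
open ℚΣ using (sum)

module LinearAlgebra where

  open import Data.Vec.Functional using (insertAt; removeAt)
  open import Data.Vec.Functional.Properties using (insertAt-lookup; insertAt-punchIn)
  open import Relation.Nullary using (¬?)
  open import Relation.Nullary.Decidable using (decidable-stable)
  open import Data.Rational using (_+_; _*_; -_; 1/_; ≢-nonZero)
  open import Data.Rational.Solver using (module +-*-Solver)
  open +-*-Solver

  *-nonZero : ∀ {p q} → p ≢ 0ℚ → q ≢ 0ℚ → p * q ≢ 0ℚ
  *-nonZero {p} {q} p≢0 q≢0 pq≡0 = q≢0 (begin
    q              ≡⟨ sym (ℚP.*-identityˡ q) ⟩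
    1ℚ * q         ≡⟨ cong (_* q) (sym (ℚP.*-inverseˡ p)) ⟩
    (1/ p * p) * q ≡⟨ ℚP.*-assoc (1/ p) p q ⟩
    1/ p * (p * q) ≡⟨ cong (1/ p *_) pq≡0 ⟩
    1/ p * 0ℚ      ≡⟨ ℚP.*-zeroʳ (1/ p) ⟩
    0ℚ             ∎)
    where open ≡-Reasoning
          instance _ = ≢-nonZero p≢0

  dot : ∀ {n} → Vector ℚ n → Vector ℚ n → ℚ
  dot r l = sum (λ j → l j * r j)

  NontrivialSolution : ∀ {n} → List (Vector ℚ n) → Set
  NontrivialSolution {n} rows =
    Σ (Vector ℚ n) λ l → (∃ λ i → l i ≢ 0ℚ) × All (λ r → dot r l ≡ 0ℚ) rows

  -- Eliminating the unknown j from the row g with the help of the pivot row r,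
  -- whose entry at j is c:  c·g − g_j·r, with the (now zero) j-th entry removed.
  eliminate : ∀ {m} (r : Vector ℚ (suc m)) (j : Fin (suc m)) →
              Vector ℚ (suc m) → Vector ℚ m
  eliminate r j g i = r j * g (punchIn j i) + - (g j * r (punchIn j i))

  backSubstitute : ∀ {m} (r : Vector ℚ (suc m)) (j : Fin (suc m)) →
                   Vector ℚ m → Vector ℚ (suc m)
  backSubstitute r j μ = insertAt (λ i → r j * μ i) j (- dot (removeAt r j) μ)

  dot-backSubstitute : ∀ {m} (r : Vector ℚ (suc m)) (j : Fin (suc m)) (μ : Vector ℚ m)
    (g : Vector ℚ (suc m)) → dot g (backSubstitute r j μ) ≡ dot (eliminate r j g) μ
  dot-backSubstitute r j μ g = begin
    dot g l
      ≡⟨ ℚΣ.sum-remove (λ k → l k * g k) ⟩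
    l j * g j + sum (λ i → l (punchIn j i) * g (punchIn j i))
      ≡⟨ cong₂ _+_ (cong (_* g j) (insertAt-lookup _ j _))
                   (ℚΣ.sum-cong-≗ (λ i → cong (_* g (punchIn j i)) (insertAt-punchIn _ j _ i))) ⟩
    - D * g j + G
      ≡⟨ solve 3 (λ D gj G → :- D :* gj :+ G := G :+ (:- gj) :* D) refl D (g j) G ⟩
    G + (- g j) * D
      ≡⟨ cong (G +_) (ℚΣ.*-distribˡ-sum (- g j) (λ i → μ i * r (punchIn j i))) ⟩
    G + sum (λ i → (- g j) * (μ i * r (punchIn j i)))
      ≡⟨ ℚΣ.∑-distrib-+ (λ i → (c * μ i) * g (punchIn j i)) (λ i → (- g j) * (μ i * r (punchIn j i))) ⟨
    sum (λ i → (c * μ i) * g (punchIn j i) + (- g j) * (μ i * r (punchIn j i)))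
      ≡⟨ ℚΣ.sum-cong-≗ (λ i → solve 5
           (λ c m gi gj ri → (c :* m) :* gi :+ (:- gj) :* (m :* ri) := m :* (c :* gi :+ :- (gj :* ri)))
           refl c (μ i) (g (punchIn j i)) (g j) (r (punchIn j i))) ⟩
    dot (eliminate r j g) μ ∎
    where
    open ≡-Reasoning
    l = backSubstitute r j μ
    c = r j
    D = dot (removeAt r j) μ
    G = sum (λ i → (c * μ i) * g (punchIn j i))

  eliminate-self : ∀ {m} (r : Vector ℚ (suc m)) (j : Fin (suc m)) (i : Fin m) →
                   eliminate r j r i ≡ 0ℚ
  eliminate-self r j i = solve 2 (λ c x → c :* x :+ :- (c :* x) := con 0ℚ) refl (r j) (r (punchIn j i))

  dot-zeroRow : ∀ {n} (r l : Vector ℚ n) → (∀ i → r i ≡ 0ℚ) → dot r l ≡ 0ℚ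
  dot-zeroRow {n} r l r≡0 = trans (ℚΣ.sum-cong-≗ (λ i → trans (cong (l i *_) (r≡0 i)) (ℚP.*-zeroʳ (l i))))
                              (ℚΣ.sum-replicate-zero n)

  zeroRowOrPivot : ∀ {n} (r : Vector ℚ n) → (∀ i → r i ≡ 0ℚ) ⊎ (∃ λ j → r j ≢ 0ℚ)
  zeroRowOrPivot r with any? (λ j → ¬? (r j ℚP.≟ 0ℚ))
  ... | yes pivot = inj₂ pivot
  ... | no noPivot = inj₁ λ i → decidable-stable (r i ℚP.≟ 0ℚ) (λ r≢0 → noPivot (i , r≢0))

  -- Gaussian elimination, by recursion on the number k of equations: either
  -- the first row vanishes and is dropped, or it has a pivot that eliminates
  -- one unknown from the remaining rows.
  eliminationBy : ∀ k {n} (rows : List (Vector ℚ n)) → length rows ≡ k → k < n →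
                  NontrivialSolution rows
  eliminationBy zero {suc m} [] _ _ = (λ _ → 1ℚ) , (zero , ℚP.1≢0) , []
  eliminationBy (suc k) {suc m} (r ∷ rs) |rs|≡k (s≤s k<m) = byCases (zeroRowOrPivot r)
    where
    byCases : (∀ i → r i ≡ 0ℚ) ⊎ (∃ λ j → r j ≢ 0ℚ) → NontrivialSolution (r ∷ rs)
    byCases (inj₁ rIsZero) =
      let l , nontrivial , solvesRs = eliminationBy k rs (suc-injective |rs|≡k) (m<n⇒m<1+n k<m)
      in l , nontrivial , dot-zeroRow r l rIsZero ∷ solvesRs
    byCases (inj₂ (j , c≢0)) =
      let μ , (i , μi≢0) , solvesReduced =
            eliminationBy k (map (eliminate r j) rs) (trans (length-map _ rs) (suc-injective |rs|≡k)) k<m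
      in backSubstitute r j μ
       , (punchIn j i , subst (_≢ 0ℚ) (sym (insertAt-punchIn _ j _ i)) (*-nonZero c≢0 μi≢0))
       , trans (dot-backSubstitute r j μ r) (dot-zeroRow _ μ (eliminate-self r j))
       ∷ All.map (λ {g} h → trans (dot-backSubstitute r j μ g) h) (map⁻ solvesReduced)

  underdetermined : ∀ {n} (rows : List (Vector ℚ n)) → length rows < n → NontrivialSolution rows
  underdetermined rows = eliminationBy (length rows) rows refl

open LinearAlgebra

-- The rational operations are used qualified from here on; the natural
-- number operations are opened only now, outside LinearAlgebra, where
-- _+_ and _*_ denote the rational ones.
open import Data.Nat using (_+_; _*_; _∸_)

bit : Bool → ℕ
bit true  = 1
bit false = 0

count : ∀ {n} → (Fin n → Bool) → ℕ
count P = ℕΣ.sum (λ i → bit (P i))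

∣∣≡count : ∀ {n} (β : Subset n) → ∣ β ∣ ≡ count (lookup β)
∣∣≡count []          = refl
∣∣≡count (true ∷ β)  = cong suc (∣∣≡count β)
∣∣≡count (false ∷ β) = ∣∣≡count β

count-complement : ∀ {n} (P : Fin n → Bool) → count (λ i → not (P i)) + count P ≡ n
count-complement {zero}  P = refl
count-complement {suc n} P with P zero
... | true  = trans (+-suc _ _) (cong suc (count-complement (λ i → P (suc i))))
... | false = cong suc (count-complement (λ i → P (suc i)))

count-∨ : ∀ {n} (A B : Fin n → Bool) → (∀ i → A i ≡ true → B i ≡ true → ⊥) →
          count (λ i → A i ∨ B i) ≡ count A + count B
count-∨ A B disjoint =
  trans (ℕΣ.sum-cong-≗ (λ i → bit-∨ (A i) (B i) (disjoint i)))
        (ℕΣ.∑-distrib-+ (λ i → bit (A i)) (λ i → bit (B i)))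
  where
  bit-∨ : ∀ a b → (a ≡ true → b ≡ true → ⊥) → bit (a ∨ b) ≡ bit a + bit b
  bit-∨ true  true  both = contradiction refl (both refl)
  bit-∨ true  false _    = refl
  bit-∨ false _     _    = refl

blocks : ∀ {A : Set} {m} → (Fin m → List A) → List A
blocks {m = zero}  f = []
blocks {m = suc m} f = f zero ++ blocks (λ i → f (suc i))

length-blocks : ∀ {A : Set} {m} (f : Fin m → List A) →
                length (blocks f) ≡ ℕΣ.sum (λ i → length (f i))
length-blocks {m = zero}  f = refl
length-blocks {m = suc m} f =
  trans (length-++ (f zero)) (cong (length (f zero) +_) (length-blocks (λ i → f (suc i))))

All-blocks : ∀ {A : Set} {Q : A → Set} {m} (f : Fin m → List A) →
             All Q (blocks f) → ∀ i → All Q (f i)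
All-blocks {m = suc m} f all zero    = ++⁻ˡ (f zero) all
All-blocks {m = suc m} f all (suc i) = All-blocks (λ i → f (suc i)) (++⁻ʳ (f zero) all) i

select : ∀ {A : Set} {m} → (Fin m → Bool) → (Fin m → A) → List A
select P f = blocks (λ i → if P i then f i ∷ [] else [])

length-select : ∀ {A : Set} {m} (P : Fin m → Bool) (f : Fin m → A) →
                length (select P f) ≡ count P
length-select P f =
  trans (length-blocks (λ i → if P i then f i ∷ [] else []))
        (ℕΣ.sum-cong-≗ (λ i → length-if (P i) (f i)))
  where
  length-if : ∀ {A : Set} b (x : A) → length (if b then x ∷ [] else []) ≡ bit b
  length-if true  x = refl
  length-if false x = refl

All-select : ∀ {A : Set} {Q : A → Set} {m} (P : Fin m → Bool) (f : Fin m → A) →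
             All Q (select P f) → ∀ i → P i ≡ true → Q (f i)
All-select P f all i Pi with P i | All-blocks (λ i → if P i then f i ∷ [] else []) all i
All-select P f all i refl | true | Qfi ∷ [] = Qfi

toℚ : ℕ → ℚ
toℚ n = ℤ.+ n ℚ./ 1

unitRow : ∀ {n} → Fin n → Vector ℚ n
unitRow i j = toℚ (indicator i j)

indicator-same : ∀ {n} (a : Fin n) → indicator a a ≡ 1
indicator-same a with a Fin.≟ a
... | yes _   = refl
... | no  a≢a = contradiction refl a≢a

indicator-diff : ∀ {n} {a b : Fin n} → a ≢ b → indicator a b ≡ 0
indicator-diff {a = a} {b} a≢b with a Fin.≟ b
... | yes a≡b = contradiction a≡b a≢b
... | no  _   = refl

sum-pick : ∀ {n} (i : Fin n) (f : Vector ℚ n) → sum (λ j → f j ℚ.* toℚ (indicator i j)) ≡ f i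
sum-pick {suc n} i f = begin
  sum (λ j → f j ℚ.* toℚ (indicator i j))
    ≡⟨ ℚΣ.sum-remove {i = i} (λ j → f j ℚ.* toℚ (indicator i j)) ⟩
  f i ℚ.* toℚ (indicator i i) ℚ.+ sum (λ k → f (punchIn i k) ℚ.* toℚ (indicator i (punchIn i k)))
    ≡⟨ cong₂ ℚ._+_ (cong (λ x → f i ℚ.* toℚ x) (indicator-same i))
                   (ℚΣ.sum-cong-≗ (λ k → cong (λ x → f (punchIn i k) ℚ.* toℚ x)
                                              (indicator-diff (punchInᵢ≢i i k ∘ sym)))) ⟩
  f i ℚ.* 1ℚ ℚ.+ sum (λ k → f (punchIn i k) ℚ.* 0ℚ)
    ≡⟨ cong₂ ℚ._+_ (ℚP.*-identityʳ (f i))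
                   (trans (ℚΣ.sum-cong-≗ (λ k → ℚP.*-zeroʳ (f (punchIn i k)))) (ℚΣ.sum-replicate-zero n)) ⟩
  f i ℚ.+ 0ℚ
    ≡⟨ ℚP.+-identityʳ (f i) ⟩
  f i ∎
  where open ≡-Reasoning

-- The c-th coordinate of Σᵢ lᵢ·α i, as the value of a linear form in l.
coordRow : ∀ {s t n} → (Fin n → Vertex s t) → Coord s t → Vector ℚ n
coordRow α c i = toℚ (coord (α i) c)

combo : ∀ {s t n} → (Fin n → Vertex s t) → Vector ℚ n → Coord s t → ℚ
combo α l c = dot (coordRow α c) l

sumℚ≡sum : ∀ {n} (f : Vector ℚ n) → sumℚ f ≡ sum f
sumℚ≡sum {zero}  f = refl
sumℚ≡sum {suc n} f = cong (f zero ℚ.+_) (sumℚ≡sum (λ i → f (suc i)))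

sumℕ≡sum : ∀ {n} (f : Fin n → ℕ) → sumℕ f ≡ ℕΣ.sum f
sumℕ≡sum {zero}  f = refl
sumℕ≡sum {suc n} f = cong (f zero +_) (sumℕ≡sum (λ i → f (suc i)))

dependence-trivial : ∀ {s t n} {α : Fin n → Vertex s t} → AffinelyIndependent α →
  (l : Vector ℚ n) → sum l ≡ 0ℚ → (∀ c → combo α l c ≡ 0ℚ) → ∀ i → l i ≡ 0ℚ
dependence-trivial {α = α} independent l Σl≡0 comboZero =
  independent l (trans (sumℚ≡sum l) Σl≡0)
    (λ c → trans (sumℚ≡sum (λ i → l i ℚ.* coordRow α c i)) (comboZero c))

-- Within one factor Δᵈ⁻¹ the coordinates of a vertex sum to 1, so the
-- coordinates of a combination of vertices sum to its total weight.
factorSum : ∀ {n d} (x : Fin n → Fin d) (l : Vector ℚ n) →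
            sum (λ a → dot (λ j → toℚ (indicator (x j) a)) l) ≡ sum l
factorSum x l =
  trans (ℚΣ.∑-comm (λ a j → l j ℚ.* toℚ (indicator (x j) a)))
        (ℚΣ.sum-cong-≗ (λ j → sum-pick (x j) (λ _ → l j)))

-- V with its first element removed.  For a factor face V these are the
-- coordinates, among those of V, that we impose on a direction vector:
-- the remaining one is determined by the block sum.
pivots : ∀ {d} → Subset d → Subset d
pivots []          = []
pivots (true ∷ V)  = false ∷ V
pivots (false ∷ V) = false ∷ pivots V

∣pivots∣ : ∀ {d} (V : Subset d) → ∣ pivots V ∣ ≡ ∣ V ∣ ∸ 1
∣pivots∣ []          = refl
∣pivots∣ (true ∷ V)  = refl
∣pivots∣ (false ∷ V) = ∣pivots∣ V

blockVanishes : ∀ {d} (V : Subset d) (g : Vector ℚ d) → sum g ≡ 0ℚ →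
  (∀ a → lookup V a ≡ false → g a ≡ 0ℚ) → (∀ a → lookup (pivots V) a ≡ true → g a ≡ 0ℚ) →
  ∀ a → g a ≡ 0ℚ
blockVanishes {suc d} (true ∷ V) g Σg≡0 outside pivot = headAndTail
  where
  tailZero : ∀ a → g (suc a) ≡ 0ℚ
  tailZero a with lookup V a in Va
  ... | true  = pivot (suc a) Va
  ... | false = outside (suc a) Va
  headZero : g zero ≡ 0ℚ
  headZero = begin
    g zero                               ≡⟨ ℚP.+-identityʳ (g zero) ⟨
    g zero ℚ.+ 0ℚ                        ≡⟨ cong (g zero ℚ.+_) (ℚΣ.sum-replicate-zero d) ⟨
    g zero ℚ.+ sum (λ (_ : Fin d) → 0ℚ)  ≡⟨ cong (g zero ℚ.+_) (ℚΣ.sum-cong-≗ tailZero) ⟨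
    sum g                                ≡⟨ Σg≡0 ⟩
    0ℚ                                   ∎
    where open ≡-Reasoning
  headAndTail : ∀ a → g a ≡ 0ℚ
  headAndTail zero    = headZero
  headAndTail (suc a) = tailZero a
blockVanishes (false ∷ V) g Σg≡0 outside pivot = headAndTail
  where
  headZero : g zero ≡ 0ℚ
  headZero = outside zero refl
  Σtail≡0 : sum (λ a → g (suc a)) ≡ 0ℚ
  Σtail≡0 = begin
    sum (λ a → g (suc a))            ≡⟨ ℚP.+-identityˡ _ ⟨
    0ℚ ℚ.+ sum (λ a → g (suc a))     ≡⟨ cong (ℚ._+ sum (λ a → g (suc a))) headZero ⟨
    g zero ℚ.+ sum (λ a → g (suc a)) ≡⟨ Σg≡0 ⟩
    0ℚ                               ∎
    where open ≡-Reasoning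
  headAndTail : ∀ a → g a ≡ 0ℚ
  headAndTail zero    = headZero
  headAndTail (suc a) =
    blockVanishes V (λ a → g (suc a)) Σtail≡0 (λ a → outside (suc a)) (λ a → pivot (suc a)) a

pivotCoords₁ : ∀ {s t} → Face s t → Fin s → List (Coord s t)
pivotCoords₁ F i = select (lookup (pivots (S F i))) (λ a → inj₁ (i , a))

pivotCoords₂ : ∀ {s t} → Face s t → Fin t → List (Coord s t)
pivotCoords₂ F j = select (lookup (pivots (T F j))) (λ a → inj₂ (j , a))

directionCoords : ∀ {s t} → Face s t → List (Coord s t)
directionCoords F = blocks (pivotCoords₁ F) ++ blocks (pivotCoords₂ F)

length-directionCoords : ∀ {s t} (F : Face s t) → length (directionCoords F) ≡ dim F
length-directionCoords {s} {t} F =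
  trans (length-++ (blocks (pivotCoords₁ F)))
        (cong₂ _+_ (factors (λ i → inj₁ ∘ (i ,_)) (S F)) (factors (λ j → inj₂ ∘ (j ,_)) (T F)))
  where
  factors : ∀ {m d} (embed : Fin m → Fin d → Coord s t) (V : Fin m → Subset d) →
            length (blocks (λ i → select (lookup (pivots (V i))) (embed i))) ≡ sumℕ (λ i → ∣ V i ∣ ∸ 1)
  factors embed V = begin
    length (blocks (λ i → select (lookup (pivots (V i))) (embed i)))
      ≡⟨ length-blocks (λ i → select (lookup (pivots (V i))) (embed i)) ⟩
    ℕΣ.sum (λ i → length (select (lookup (pivots (V i))) (embed i)))
      ≡⟨ ℕΣ.sum-cong-≗ (λ i → trans (length-select _ (embed i))
                               (trans (sym (∣∣≡count (pivots (V i)))) (∣pivots∣ (V i)))) ⟩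
    ℕΣ.sum (λ i → ∣ V i ∣ ∸ 1)
      ≡⟨ sumℕ≡sum (λ i → ∣ V i ∣ ∸ 1) ⟨
    sumℕ (λ i → ∣ V i ∣ ∸ 1) ∎
    where open ≡-Reasoning

member-≢ : ∀ {d} (V : Subset d) {x a : Fin d} → x ∈ V → lookup V a ≡ false → x ≢ a
member-≢ V x∈V a∉V refl with () ← trans (sym ([]=⇒lookup x∈V)) a∉V

outside-notFree₁ : ∀ {s t} (F : Face s t) i a → lookup (S F i) a ≡ false → ¬ Free F (inj₁ (i , a))
outside-notFree₁ F i a a∉ (notAllZero , _) =
  notAllZero λ v v∈F → indicator-diff (member-≢ (S F i) (proj₁ v∈F i) a∉)

outside-notFree₂ : ∀ {s t} (F : Face s t) j a → lookup (T F j) a ≡ false → ¬ Free F (inj₂ (j , a))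
outside-notFree₂ F j a a∉ (notAllZero , _) =
  notAllZero λ v v∈F → indicator-diff (member-≢ (T F j) (proj₂ v∈F j) a∉)

directionVanishes : ∀ {s t n} (α : Fin n → Vertex s t) (F : Face s t) (l : Vector ℚ n) →
  sum l ≡ 0ℚ → (∀ c → ¬ Free F c → combo α l c ≡ 0ℚ) →
  All (λ c → combo α l c ≡ 0ℚ) (directionCoords F) → ∀ c → combo α l c ≡ 0ℚ
directionVanishes α F l Σl≡0 nonFree pivotsVanish (inj₁ (i , a)) =
  blockVanishes (S F i) (λ a → combo α l (inj₁ (i , a)))
    (trans (factorSum (λ k → fst₁ (α k) i) l) Σl≡0)
    (λ b b∉ → nonFree (inj₁ (i , b)) (outside-notFree₁ F i b b∉))
    (All-select _ (λ a → inj₁ (i , a)) (All-blocks (pivotCoords₁ F) (++⁻ˡ _ pivotsVanish) i)) a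
directionVanishes α F l Σl≡0 nonFree pivotsVanish (inj₂ (j , a)) =
  blockVanishes (T F j) (λ a → combo α l (inj₂ (j , a)))
    (trans (factorSum (λ k → snd₂ (α k) j) l) Σl≡0)
    (λ b b∉ → nonFree (inj₂ (j , b)) (outside-notFree₂ F j b b∉))
    (All-select _ (λ a → inj₂ (j , a))
                (All-blocks (pivotCoords₂ F) (++⁻ʳ (blocks (pivotCoords₁ F)) pivotsVanish) j)) a

SupportedOn : ∀ {n} → (Fin n → Bool) → Vector ℚ n → Set
SupportedOn U l = ∀ i → U i ≡ false → l i ≡ 0ℚ

-- Suppose that every weight vector l supported on U and satisfying the
-- extra equations R is an affine dependence "modulo the direction of F":
-- it has total weight 0 and vanishes on the coordinates that are not free
-- on F.  Then at most |R| + dim F of the affinely independent vertices α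
-- are indexed by U.  (Otherwise the equations "supported on U", R and
-- directionCoords F have a nontrivial solution, which is an affine
-- dependence by directionVanishes.)
dimensionBound : ∀ {s t n} {α : Fin n → Vertex s t} → AffinelyIndependent α →
  (U : Fin n → Bool) (F : Face s t) (R : List (Vector ℚ n)) →
  length R + dim F < count U →
  (∀ l → SupportedOn U l → All (λ r → dot r l ≡ 0ℚ) R →
     sum l ≡ 0ℚ × (∀ c → ¬ Free F c → combo α l c ≡ 0ℚ)) →
  ⊥
dimensionBound {n = n} {α} independent U F R tooMany forced =
  noNontrivialSolution (underdetermined rows fewerRowsThanUnknowns)
  where
  outside = λ i → not (U i)
  rows = select outside unitRow ++ R ++ map (coordRow α) (directionCoords F)

  length-rows : length rows ≡ count outside + (length R + dim F)
  length-rows = begin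
    length rows
      ≡⟨ length-++ (select outside unitRow) ⟩
    length (select outside unitRow) + length (R ++ map (coordRow α) (directionCoords F))
      ≡⟨ cong₂ _+_ (length-select outside unitRow) (length-++ R) ⟩
    count outside + (length R + length (map (coordRow α) (directionCoords F)))
      ≡⟨ cong (λ k → count outside + (length R + k))
              (trans (length-map (coordRow α) (directionCoords F)) (length-directionCoords F)) ⟩
    count outside + (length R + dim F) ∎
    where open ≡-Reasoning

  fewerRowsThanUnknowns : length rows < n
  fewerRowsThanUnknowns =
    subst₂ _<_ (sym length-rows) (count-complement U) (ℕP.+-monoʳ-< (count outside) tooMany)

  noNontrivialSolution : NontrivialSolution rows → ⊥
  noNontrivialSolution (l , (i , li≢0) , solves) =
    li≢0 (dependence-trivial independent l Σl≡0 comboZero i)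
    where
    supported : SupportedOn U l
    supported i Ui≡false =
      trans (sym (sum-pick i l)) (All-select outside unitRow (++⁻ˡ _ solves) i (cong not Ui≡false))
    solvesRest = ++⁻ʳ (select outside unitRow) solves
    forcedByR = forced l supported (++⁻ˡ R solvesRest)
    Σl≡0 = proj₁ forcedByR
    comboZero : ∀ c → combo α l c ≡ 0ℚ
    comboZero = directionVanishes α F l Σl≡0 (proj₂ forcedByR) (map⁻ (++⁻ʳ R solvesRest))

-- Every coordinate that is not free on F takes one value on the vertices
-- α i with i ∈ A: these vertices lie in one translate of the face F.
Aligned : ∀ {s t n} → (Fin n → Vertex s t) → Face s t → (Fin n → Bool) → Set
Aligned α F A = ∀ c → ¬ Free F c → ∀ {i j} → A i ≡ true → A j ≡ true → coord (α i) c ≡ coord (α j) c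

constantCombo : ∀ {n} (A : Fin n → Bool) (x l : Vector ℚ n) → SupportedOn A l →
  (∀ {i j} → A i ≡ true → A j ≡ true → x i ≡ x j) → sum l ≡ 0ℚ → dot x l ≡ 0ℚ
constantCombo A x l supported constant Σl≡0 = valueOnA (proj₁ constantValue) (proj₂ constantValue)
  where
  constantValue : Σ ℚ λ v → ∀ {i} → A i ≡ true → x i ≡ v
  constantValue with any? (λ i → A i Bool.≟ true)
  ... | yes (i₀ , Ai₀) = x i₀ , λ Ai → constant Ai Ai₀
  ... | no  emptyA     = 0ℚ , λ {i} Ai → contradiction (i , Ai) emptyA

  valueOnA : ∀ v → (∀ {i} → A i ≡ true → x i ≡ v) → dot x l ≡ 0ℚ
  valueOnA v xᵢ≡v = begin
    sum (λ i → l i ℚ.* x i)  ≡⟨ ℚΣ.sum-cong-≗ (λ i → weigh i (A i) refl) ⟩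
    sum (λ i → v ℚ.* l i)    ≡⟨ ℚΣ.*-distribˡ-sum v l ⟨
    v ℚ.* sum l              ≡⟨ cong (v ℚ.*_) Σl≡0 ⟩
    v ℚ.* 0ℚ                 ≡⟨ ℚP.*-zeroʳ v ⟩
    0ℚ                       ∎
    where
    open ≡-Reasoning
    weigh : ∀ i b → A i ≡ b → l i ℚ.* x i ≡ v ℚ.* l i
    weigh i true  Ai = trans (cong (l i ℚ.*_) (xᵢ≡v Ai)) (ℚP.*-comm (l i) v)
    weigh i false Ai rewrite supported i Ai = trans (ℚP.*-zeroˡ (x i)) (sym (ℚP.*-zeroʳ v))

oneTranslate : ∀ {s t n} {α : Fin n → Vertex s t} → AffinelyIndependent α →
  (U : Fin n → Bool) (F : Face s t) → Aligned α F U → 1 + dim F < count U → ⊥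
oneTranslate {α = α} independent U F aligned tooMany =
  dimensionBound independent U F (allOnes ∷ []) tooMany forced
  where
  allOnes = λ _ → 1ℚ
  forced : ∀ l → SupportedOn U l → All (λ r → dot r l ≡ 0ℚ) (allOnes ∷ []) →
           sum l ≡ 0ℚ × (∀ c → ¬ Free F c → combo α l c ≡ 0ℚ)
  forced l supported (Σl≡0 ∷ []) =
    Σl≡0′ , λ c notFree → constantCombo U (coordRow α c) l supported
                            (λ Ui Uj → cong toℚ (aligned c notFree Ui Uj)) Σl≡0′
    where Σl≡0′ = trans (ℚΣ.sum-cong-≗ (λ i → sym (ℚP.*-identityʳ (l i)))) Σl≡0

splitWeight : ∀ q a b → (a ≡ true → b ≡ true → ⊥) → (a ∨ b ≡ false → q ≡ 0ℚ) →
              q ≡ q ℚ.* toℚ (bit a) ℚ.+ q ℚ.* toℚ (bit b)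
splitWeight q true  true  disjoint _ = contradiction refl (disjoint refl)
splitWeight q true  false _ _ =
  sym (trans (cong₂ ℚ._+_ (ℚP.*-identityʳ q) (ℚP.*-zeroʳ q)) (ℚP.+-identityʳ q))
splitWeight q false true  _ _ =
  sym (trans (cong₂ ℚ._+_ (ℚP.*-zeroʳ q) (ℚP.*-identityʳ q)) (ℚP.+-identityˡ q))
splitWeight q false false _ q≡0 rewrite q≡0 refl = refl

twoTranslates : ∀ {s t n} {α : Fin n → Vertex s t} → AffinelyIndependent α →
  (A B : Fin n → Bool) (F : Face s t) → (∀ i → A i ≡ true → B i ≡ true → ⊥) →
  Aligned α F A → Aligned α F B → 2 + dim F < count A + count B → ⊥
twoTranslates {α = α} independent A B F disjoint alignedA alignedB tooMany =
  dimensionBound independent (λ i → A i ∨ B i) F (indicatorRow A ∷ indicatorRow B ∷ [])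
    (subst (2 + dim F <_) (sym (count-∨ A B disjoint)) tooMany) forced
  where
  indicatorRow : (Fin _ → Bool) → Vector ℚ _
  indicatorRow P i = toℚ (bit (P i))

  restrict : (Fin _ → Bool) → Vector ℚ _ → Vector ℚ _
  restrict P l i = l i ℚ.* indicatorRow P i

  restrict-supported : ∀ P l → SupportedOn P (restrict P l)
  restrict-supported P l i Pi≡false rewrite Pi≡false = ℚP.*-zeroʳ (l i)

  split : ∀ l → SupportedOn (λ i → A i ∨ B i) l → ∀ i → l i ≡ restrict A l i ℚ.+ restrict B l i
  split l supported i = splitWeight (l i) (A i) (B i) (disjoint i) (supported i)

  forced : ∀ l → SupportedOn (λ i → A i ∨ B i) l →
           All (λ r → dot r l ≡ 0ℚ) (indicatorRow A ∷ indicatorRow B ∷ []) →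
           sum l ≡ 0ℚ × (∀ c → ¬ Free F c → combo α l c ≡ 0ℚ)
  forced l supported (ΣlA≡0 ∷ ΣlB≡0 ∷ []) = Σl≡0 , comboZero
    where
    lA = restrict A l
    lB = restrict B l
    Σl≡0 : sum l ≡ 0ℚ
    Σl≡0 = begin
      sum l                      ≡⟨ ℚΣ.sum-cong-≗ (split l supported) ⟩
      sum (λ i → lA i ℚ.+ lB i)  ≡⟨ ℚΣ.∑-distrib-+ lA lB ⟩
      sum lA ℚ.+ sum lB          ≡⟨ cong₂ ℚ._+_ ΣlA≡0 ΣlB≡0 ⟩
      0ℚ                         ∎
      where open ≡-Reasoning
    comboZero : ∀ c → ¬ Free F c → combo α l c ≡ 0ℚ
    comboZero c notFree = begin
      sum (λ i → l i ℚ.* x i)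
        ≡⟨ ℚΣ.sum-cong-≗ (λ i → cong (ℚ._* x i) (split l supported i)) ⟩
      sum (λ i → (lA i ℚ.+ lB i) ℚ.* x i)
        ≡⟨ ℚΣ.sum-cong-≗ (λ i → ℚP.*-distribʳ-+ (x i) (lA i) (lB i)) ⟩
      sum (λ i → lA i ℚ.* x i ℚ.+ lB i ℚ.* x i)
        ≡⟨ ℚΣ.∑-distrib-+ (λ i → lA i ℚ.* x i) (λ i → lB i ℚ.* x i) ⟩
      dot x lA ℚ.+ dot x lB
        ≡⟨ cong₂ ℚ._+_ (partZero A alignedA ΣlA≡0) (partZero B alignedB ΣlB≡0) ⟩
      0ℚ ∎
      where
      open ≡-Reasoning
      x = coordRow α c
      partZero : ∀ P → Aligned α F P → sum (restrict P l) ≡ 0ℚ → dot x (restrict P l) ≡ 0ℚ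
      partZero P aligned = constantCombo P x (restrict P l) (restrict-supported P l)
                             (λ Pi Pj → cong toℚ (aligned c notFree Pi Pj))

indicator-0or1 : ∀ {d} (a b : Fin d) → indicator a b ≡ 0 ⊎ indicator a b ≡ 1
indicator-0or1 a b with a Fin.≟ b
... | yes _ = inj₂ refl
... | no  _ = inj₁ refl

coord-0or1 : ∀ {s t} (v : Vertex s t) c → coord v c ≡ 0 ⊎ coord v c ≡ 1
coord-0or1 v (inj₁ (i , a)) = indicator-0or1 (fst₁ v i) a
coord-0or1 v (inj₂ (j , a)) = indicator-0or1 (snd₂ v j) a

takesBothValues-free : ∀ {s t} (F : Face s t) c {v w} → v ∈F F → w ∈F F →
                       coord v c ≡ 0 → coord w c ≡ 1 → Free F c
takesBothValues-free F c {v} {w} v∈F w∈F v₀ w₁ =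
  (λ allZero → ℕP.0≢1+n (trans (sym (allZero w w∈F)) w₁)) ,
  (λ allOne  → ℕP.0≢1+n (trans (sym v₀) (allOne v v∈F)))

notFree-constant : ∀ {s t} (F : Face s t) c → ¬ Free F c →
                   ∀ {v w} → v ∈F F → w ∈F F → coord v c ≡ coord w c
notFree-constant F c notFree {v} {w} v∈F w∈F with coord-0or1 v c | coord-0or1 w c
... | inj₁ v₀ | inj₁ w₀ = trans v₀ (sym w₀)
... | inj₂ v₁ | inj₂ w₁ = trans v₁ (sym w₁)
... | inj₁ v₀ | inj₂ w₁ = contradiction (takesBothValues-free F c v∈F w∈F v₀ w₁) notFree
... | inj₂ v₁ | inj₁ w₀ = contradiction (takesBothValues-free F c w∈F v∈F w₀ v₁) notFree

Parallel-sym : ∀ {s t} {F G : Face s t} → Parallel F G → Parallel G F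
Parallel-sym parallel c = proj₂ (parallel c) , proj₁ (parallel c)

inFace-aligned : ∀ {s t n} {α : Fin n → Vertex s t} (F : Face s t) {A : Fin n → Bool} →
                 (∀ i → A i ≡ true → α i ∈F F) → Aligned α F A
inFace-aligned F inF c notFree Ai Aj = notFree-constant F c notFree (inF _ Ai) (inF _ Aj)

parallel-aligned : ∀ {s t n} {α : Fin n → Vertex s t} {F G : Face s t} {A : Fin n → Bool} →
                   Parallel F G → Aligned α G A → Aligned α F A
parallel-aligned parallel aligned c notFreeF = aligned c (λ freeG → notFreeF (proj₂ (parallel c) freeG))

commonVertex-aligned : ∀ {s t n} {α : Fin n → Vertex s t} {F G : Face s t} {A B : Fin n → Bool} {w : Vertex s t} →
  Parallel F G → (∀ i → A i ≡ true → α i ∈F F) → (∀ i → B i ≡ true → α i ∈F G) →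
  w ∈F F → w ∈F G → Aligned α F (λ i → A i ∨ B i)
commonVertex-aligned {α = α} {F} {G} {A} {B} {w} parallel inF inG w∈F w∈G c notFreeF {i} {j} ABi ABj =
  trans (asAtW i ABi) (sym (asAtW j ABj))
  where
  notFreeG : ¬ Free G c
  notFreeG freeG = notFreeF (proj₂ (parallel c) freeG)
  asAtW : ∀ i → A i ∨ B i ≡ true → coord (α i) c ≡ coord w c
  asAtW i ABi with A i in Ai
  ... | true  = notFree-constant F c notFreeF (inF i Ai) w∈F
  ... | false = notFree-constant G c notFreeG (inG i ABi) w∈G

members : ∀ {n} {P : Fin n → Set} (β : Subset n) → (∀ i → i ∈ β → P i) →
          ∀ i → lookup β i ≡ true → P i
members β holds i i∈β = holds i (lookup⇒[]= i β i∈β)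

-- Two exterior faces with disjoint vertex sets, in parallel faces F₁ and
-- F₂: their (k₁ + 1) + (k₂ + 1) vertices lie in two translates of F₁,
-- which is too many as soon as k₂ ≥ 1.
disjointExterior : ∀ {s t n} (α : Fin n → Vertex s t) → AffinelyIndependent α →
  (β₁ β₂ : Subset n) (k₁ k₂ : ℕ) (F₁ F₂ : Face s t) →
  ExteriorIn α β₁ k₁ F₁ → ExteriorIn α β₂ k₂ F₂ → Parallel F₁ F₂ → 1 ≤ k₂ →
  (∀ i → lookup β₁ i ≡ true → lookup β₂ i ≡ true → ⊥) → ⊥
disjointExterior α independent β₁ β₂ k₁ k₂ F₁ F₂
                 (|β₁| , dimF₁ , β₁⊆F₁) (|β₂| , _ , β₂⊆F₂) parallel 1≤k₂ disjoint =
  twoTranslates independent (lookup β₁) (lookup β₂) F₁ disjoint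
    (inFace-aligned F₁ (members β₁ β₁⊆F₁))
    (parallel-aligned {F = F₁} {F₂} parallel (inFace-aligned F₂ (members β₂ β₂⊆F₂)))
    (subst₂ (λ d c → 2 + d < c) (sym dimF₁) (sym (cong₂ _+_ count₁ count₂)) tooMany)
  where
  count₁ = trans (sym (∣∣≡count β₁)) |β₁|
  count₂ = trans (sym (∣∣≡count β₂)) |β₂|
  tooMany : 2 + k₁ < suc k₁ + suc k₂
  tooMany = subst (_< suc k₁ + suc k₂) (cong suc (ℕP.+-comm k₁ 1)) (ℕP.+-monoʳ-< (suc k₁) (s≤s 1≤k₂))

-- An exterior face β in F, a vertex j ∉ β in a face G parallel to F, and a
-- vertex i₀ ∈ β also in G: then the k + 2 vertices of β ∪ {j} lie in one
-- translate of F, which has dimension k.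
overlappingExterior : ∀ {s t n} (α : Fin n → Vertex s t) → AffinelyIndependent α →
  (β : Subset n) (k : ℕ) (F G : Face s t) → ExteriorIn α β k F → Parallel F G →
  (j : Fin n) → lookup β j ≡ false → α j ∈F G →
  (i₀ : Fin n) → lookup β i₀ ≡ true → α i₀ ∈F G → ⊥
overlappingExterior α independent β k F G (|β| , dimF , β⊆F) parallel j j∉β j∈G i₀ i₀∈β i₀∈G =
  oneTranslate independent (λ i → lookup β i ∨ lookup ⁅ j ⁆ i) F
    (commonVertex-aligned {F = F} {G} parallel (members β β⊆F) onlyJ (members β β⊆F i₀ i₀∈β) i₀∈G)
    (subst₂ (λ d c → 1 + d < c) (sym dimF) (sym countβ∪j) (ℕP.m<m+n (suc k) (s≤s z≤n)))
  where
  isJ : ∀ i → lookup ⁅ j ⁆ i ≡ true → i ≡ j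
  isJ i i∈⁅j⁆ = x∈⁅y⁆⇒x≡y j (lookup⇒[]= i ⁅ j ⁆ i∈⁅j⁆)
  onlyJ : ∀ i → lookup ⁅ j ⁆ i ≡ true → α i ∈F G
  onlyJ i i∈⁅j⁆ rewrite isJ i i∈⁅j⁆ = j∈G
  disjoint : ∀ i → lookup β i ≡ true → lookup ⁅ j ⁆ i ≡ true → ⊥
  disjoint i i∈β i∈⁅j⁆ rewrite isJ i i∈⁅j⁆ with () ← trans (sym j∉β) i∈β
  countβ∪j : count (λ i → lookup β i ∨ lookup ⁅ j ⁆ i) ≡ suc k + 1
  countβ∪j = begin
    count (λ i → lookup β i ∨ lookup ⁅ j ⁆ i)  ≡⟨ count-∨ (lookup β) (lookup ⁅ j ⁆) disjoint ⟩
    count (lookup β) + count (lookup ⁅ j ⁆)    ≡⟨ cong₂ _+_ (∣∣≡count β) (∣∣≡count ⁅ j ⁆) ⟨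
    ∣ β ∣ + ∣ ⁅ j ⁆ ∣                           ≡⟨ cong₂ _+_ |β| (∣⁅x⁆∣≡1 j) ⟩
    suc k + 1                                  ∎
    where open ≡-Reasoning

distinct-differ : ∀ {n} (β₁ β₂ : Subset n) → β₁ ≢ β₂ →
  ∃ λ j → (lookup β₁ j ≡ false × lookup β₂ j ≡ true) ⊎ (lookup β₁ j ≡ true × lookup β₂ j ≡ false)
distinct-differ β₁ β₂ β₁≢β₂ with all? (λ i → lookup β₁ i Bool.≟ lookup β₂ i)
... | yes sameEverywhere = contradiction (extensional sameEverywhere) β₁≢β₂
  where
  extensional : (∀ i → lookup β₁ i ≡ lookup β₂ i) → β₁ ≡ β₂
  extensional same = trans (sym (tabulate∘lookup β₁)) (trans (tabulate-cong same) (tabulate∘lookup β₂))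
... | no notEverywhere with ¬∀⟶∃¬ _ _ (λ i → lookup β₁ i Bool.≟ lookup β₂ i) notEverywhere
...   | j , differ with lookup β₁ j in β₁j | lookup β₂ j in β₂j
...     | false | true  = j , inj₁ (β₁j , β₂j)
...     | true  | false = j , inj₂ (β₁j , β₂j)
...     | false | false = contradiction refl differ
...     | true  | true  = contradiction refl differ

-- Proposition 11.  If the vertex sets of the two exterior faces are
-- disjoint, use disjointExterior.  Otherwise they share a vertex i₀ and,
-- being distinct, one contains a vertex j outside the other; then
-- overlappingExterior applies, with the roles of the faces chosen so that
-- j lies outside the first.
proposition11 : (s t : ℕ) (α : Fin (s + 2 * t + 1) → Vertex s t) →
    AffinelyIndependent α →
    (β₁ β₂ : Subset (s + 2 * t + 1)) (k₁ k₂ : ℕ) (F₁ F₂ : Face s t) →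
    β₁ ≢ β₂ → 1 ≤ k₁ → 1 ≤ k₂ →
    ExteriorIn α β₁ k₁ F₁ → ExteriorIn α β₂ k₂ F₂ →
    Parallel F₁ F₂ → ⊥
proposition11 s t α independent β₁ β₂ k₁ k₂ F₁ F₂ β₁≢β₂ _ 1≤k₂ ext₁ ext₂ parallel
  with any? (λ i → (lookup β₁ i Bool.≟ true) ×-dec (lookup β₂ i Bool.≟ true))
... | no noCommon =
  disjointExterior α independent β₁ β₂ k₁ k₂ F₁ F₂ ext₁ ext₂ parallel 1≤k₂
    (λ i i∈β₁ i∈β₂ → noCommon (i , i∈β₁ , i∈β₂))
... | yes (i₀ , i₀∈β₁ , i₀∈β₂) with distinct-differ β₁ β₂ β₁≢β₂
...   | j , inj₁ (j∉β₁ , j∈β₂) =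
  overlappingExterior α independent β₁ k₁ F₁ F₂ ext₁ parallel
    j j∉β₁ (inF₂ j j∈β₂) i₀ i₀∈β₁ (inF₂ i₀ i₀∈β₂)
  where inF₂ = members β₂ (proj₂ (proj₂ ext₂))
...   | j , inj₂ (j∈β₁ , j∉β₂) =
  overlappingExterior α independent β₂ k₂ F₂ F₁ ext₂ (Parallel-sym {F = F₁} {F₂} parallel)
    j j∉β₂ (inF₁ j j∈β₁) i₀ i₀∈β₂ (inF₁ i₀ i₀∈β₁)
  where inF₁ = members β₁ (proj₂ (proj₂ ext₁))
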